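{- Let $\mathcal I$ be the set of all finite sets of pairwise disjoint closed intervals $[a,b]$ with $a,b$ rational and $0\le a<b\le 1$, and for $A,B\in\mathcal I$ put $A\le_{\mathcal I}B$ if every interval of $A$ is contained in some interval of $B$. Then $(\mathcal I,\le_{\mathcal I})$ is dense: for all $A,B\in\mathcal I$ with $A<_{\mathcal I}B$ there exists $C\in\mathcal I$ with $A<_{\mathcal I}C<_{\mathcal I}B$. -}

module Defs where

open import Data.Rational using (ℚ; _≤_; _<_; 0ℚ; 1ℚ)
open import Data.List using (List)
open import Data.List.Relation.Unary.All using (All)
open import Data.List.Relation.Unary.Any using (Any)
open import Data.List.Relation.Unary.AllPairs using (AllPairs)
open import Data.Product using (_×_)
open import Data.Sum using (_⊎_)
open import Relation.Nullary using (¬_)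

record Interval : Set where
  constructor [_,_]⟨_,_,_⟩
  field
    lo hi : ℚ
    0≤lo : 0ℚ ≤ lo
    lo<hi : lo < hi
    hi≤1 : hi ≤ 1ℚ
open Interval public

Disjoint : Interval → Interval → Set
Disjoint I J = hi I < lo J ⊎ hi J < lo I

_⊆ᵢ_ : Interval → Interval → Set
I ⊆ᵢ J = lo J ≤ lo I × hi I ≤ hi J

-- An element of 𝓘: a finite set of pairwise disjoint intervals, represented by a list
-- of pairwise disjoint intervals (disjointness excludes repetitions).
record 𝓘 : Set where
  constructor mk𝓘
  field
    intervals : List Interval
    disjoint  : AllPairs Disjoint intervals
open 𝓘 public

_≤𝓘_ : 𝓘 → 𝓘 → Set
A ≤𝓘 B = All (λ I → Any (λ J → I ⊆ᵢ J) (intervals B)) (intervals A)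

_<𝓘_ : 𝓘 → 𝓘 → Set
A <𝓘 B = A ≤𝓘 B × ¬ (B ≤𝓘 A)

-- Since B ≰ A, some interval J of B lies in no interval of A. Pick a point b with
-- lo J ≤ b < hi J that lies in no half-open interval [lo Z, hi Z) of A: if lo J is
-- covered by some X of A take b = hi X, which is < hi J because J ⊈ X and is missed
-- by the other intervals of A by disjointness; otherwise take b = lo J. Then A leaves
-- room just to the right of b for a small interval K ⊆ J, and C = A ∪ {K} works:
-- A < C because K lies in no interval of A, and C < B because J lies neither in K
-- nor in an interval of A.
module Submission where

open import Defs
open import Data.Product using (Σ; _×_; _,_)
open import Data.Rational using (ℚ; _≤_; _<_; _⊓_; 0ℚ; 1ℚ)
open import Data.Rational.Properties
  using (≤-refl; ≤-trans; <-trans; <⇒≤; ≮⇒≥; ≰⇒>; <-irrefl; <-dense; <-≤-trans; ≤-<-trans;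
         ⊓-sel; p⊓q≤p; p⊓q≤q; _<?_; _≤?_)
open import Data.List using (List; []; _∷_)
open import Data.List.Relation.Unary.All as All using (All; []; _∷_)
open import Data.List.Relation.Unary.All.Properties using (¬All⇒Any¬; ¬Any⇒All¬)
open import Data.List.Relation.Unary.Any as Any using (Any; here; there; any?)
open import Data.List.Relation.Unary.AllPairs using (AllPairs; _∷_)
open import Data.List.Membership.Propositional using (_∈_; find; lose)
open import Data.Sum using (_⊎_; inj₁; inj₂; swap; map₂)
open import Relation.Nullary using (¬_; Dec; yes; no)
open import Relation.Nullary.Decidable using (_×-dec_)
open import Relation.Binary.Definitions using (Decidable)
open import Relation.Binary.PropositionalEquality using (refl)

<-⊓ : ∀ {r p q} → r < p → r < q → r < p ⊓ q
<-⊓ {p = p} {q} r<p r<q with ⊓-sel p q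
... | inj₁ p⊓q≡p rewrite p⊓q≡p = r<p
... | inj₂ p⊓q≡q rewrite p⊓q≡q = r<q

⊆ᵢ-refl : ∀ I → I ⊆ᵢ I
⊆ᵢ-refl I = ≤-refl , ≤-refl

_⊆ᵢ?_ : Decidable _⊆ᵢ_
I ⊆ᵢ? J = (lo J ≤? lo I) ×-dec (hi I ≤? hi J)

Disjoint-sym : ∀ {I J} → Disjoint I J → Disjoint J I
Disjoint-sym = swap

Disjoint⇒⊈ : ∀ {I J} → Disjoint I J → ¬ I ⊆ᵢ J
Disjoint⇒⊈ {I} (inj₁ hiI<loJ) (loJ≤loI , _) =
  <-irrefl refl (<-≤-trans (<-trans (lo<hi I) hiI<loJ) loJ≤loI)
Disjoint⇒⊈ {I} (inj₂ hiJ<loI) (_ , hiI≤hiJ) =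
  <-irrefl refl (<-trans (<-≤-trans (lo<hi I) hiI≤hiJ) hiJ<loI)

_∈[_⟩ : ℚ → Interval → Set
b ∈[ Z ⟩ = lo Z ≤ b × b < hi Z

_∉[_⟩ : ℚ → Interval → Set
b ∉[ Z ⟩ = hi Z ≤ b ⊎ b < lo Z

_∈[_⟩? : ∀ b Z → Dec (b ∈[ Z ⟩)
b ∈[ Z ⟩? = (lo Z ≤? b) ×-dec (b <? hi Z)

¬∈[⟩⇒∉[⟩ : ∀ {b} Z → ¬ b ∈[ Z ⟩ → b ∉[ Z ⟩
¬∈[⟩⇒∉[⟩ {b} Z b∉Z with b <? lo Z
... | yes b<loZ = inj₂ b<loZ
... | no b≮loZ = inj₁ (≮⇒≥ (λ b<hiZ → b∉Z (≮⇒≥ b≮loZ , b<hiZ)))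

Disjoint⇒hi∉[⟩ : ∀ {X Z} → Disjoint X Z → hi X ∉[ Z ⟩
Disjoint⇒hi∉[⟩ (inj₁ hiX<loZ) = inj₂ hiX<loZ
Disjoint⇒hi∉[⟩ {X} (inj₂ hiZ<loX) = inj₁ (<⇒≤ (<-trans hiZ<loX (lo<hi X)))

hi∉[⟩-pairwiseDisjoint : ∀ {X zs} → AllPairs Disjoint zs → X ∈ zs → All (hi X ∉[_⟩) zs
hi∉[⟩-pairwiseDisjoint {X} (X#zs ∷ _) (here refl) =
  inj₁ ≤-refl ∷ All.map (λ {Z} → Disjoint⇒hi∉[⟩ {X} {Z}) X#zs
hi∉[⟩-pairwiseDisjoint {X} {Z ∷ _} (Z#zs ∷ disj) (there X∈zs) =
  Disjoint⇒hi∉[⟩ {X} {Z} (Disjoint-sym {Z} {X} (All.lookup Z#zs X∈zs)) ∷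
  hi∉[⟩-pairwiseDisjoint disj X∈zs

cut-point : ∀ {zs} → AllPairs Disjoint zs → (J : Interval) → ¬ Any (J ⊆ᵢ_) zs →
            Σ ℚ λ b → lo J ≤ b × b < hi J × All (b ∉[_⟩) zs
cut-point {zs} disj J J⊈zs with any? (lo J ∈[_⟩?) zs
... | no loJ∉zs = lo J , ≤-refl , lo<hi J , All.map (λ {Z} → ¬∈[⟩⇒∉[⟩ Z) (¬Any⇒All¬ zs loJ∉zs)
... | yes loJ∈zs with find loJ∈zs
...   | X , X∈zs , (loX≤loJ , loJ<hiX) =
  hi X , <⇒≤ loJ<hiX , ≰⇒> (λ hiJ≤hiX → J⊈zs (lose X∈zs (loX≤loJ , hiJ≤hiX))) ,
  hi∉[⟩-pairwiseDisjoint disj X∈zs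

gap-above : ∀ {b d} → b < d → (zs : List Interval) → All (b ∉[_⟩) zs →
            Σ ℚ λ t → b < t × t ≤ d × All (λ Z → hi Z ≤ b ⊎ t ≤ lo Z) zs
gap-above {d = d} b<d [] [] = d , b<d , ≤-refl , []
gap-above b<d (Z ∷ zs) (b∉Z ∷ b∉zs) with gap-above b<d zs b∉zs | b∉Z
... | t , b<t , t≤d , clear | inj₁ hiZ≤b = t , b<t , t≤d , inj₁ hiZ≤b ∷ clear
... | t , b<t , t≤d , clear | inj₂ b<loZ =
  t ⊓ lo Z , <-⊓ b<t b<loZ , ≤-trans t⊓loZ≤t t≤d ,
  inj₂ (p⊓q≤q t (lo Z)) ∷ All.map (map₂ (≤-trans t⊓loZ≤t)) clear
  where t⊓loZ≤t = p⊓q≤p t (lo Z)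

fresh-interval : ∀ {b d} → 0ℚ ≤ b → b < d → d ≤ 1ℚ → (zs : List Interval) → All (b ∉[_⟩) zs →
                 Σ Interval λ K → b < lo K × hi K ≤ d × All (Disjoint K) zs
fresh-interval {b} 0≤b b<d d≤1 zs b∉zs with gap-above b<d zs b∉zs
... | t , b<t , t≤d , clear with <-dense b<t
...   | m , b<m , m<t with <-dense b<m
...     | l , b<l , l<m = K , b<l , ≤-trans (<⇒≤ m<t) t≤d , All.map (λ {Z} → disjoint-from-K {Z}) clear
  where
  K : Interval
  K = [ l , m ]⟨ ≤-trans 0≤b (<⇒≤ b<l) , l<m , ≤-trans (<⇒≤ m<t) (≤-trans t≤d d≤1) ⟩

  disjoint-from-K : ∀ {Z} → hi Z ≤ b ⊎ t ≤ lo Z → Disjoint K Z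
  disjoint-from-K (inj₁ hiZ≤b) = inj₂ (≤-<-trans hiZ≤b b<l)
  disjoint-from-K (inj₂ t≤loZ) = inj₁ (<-≤-trans m<t t≤loZ)

≰𝓘⇒uncovered : ∀ B A → ¬ B ≤𝓘 A → Σ Interval λ J → J ∈ intervals B × ¬ Any (J ⊆ᵢ_) (intervals A)
≰𝓘⇒uncovered B A B≰A =
  find (¬All⇒Any¬ (λ J → any? (J ⊆ᵢ?_) (intervals A)) (intervals B) B≰A)

insert : (K : Interval) (A : 𝓘) → All (Disjoint K) (intervals A) → 𝓘
insert K A K#A = mk𝓘 (K ∷ intervals A) (K#A ∷ disjoint A)

≤𝓘-insert : ∀ K A K#A → A ≤𝓘 insert K A K#A
≤𝓘-insert _ A _ = All.tabulate (λ {I} I∈A → lose (there I∈A) (⊆ᵢ-refl I))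

insert-≰𝓘 : ∀ K A K#A → ¬ insert K A K#A ≤𝓘 A
insert-≰𝓘 K A K#A (K⊆A ∷ _) with All.lookupAny K#A K⊆A
... | K#Z , K⊆Z = Disjoint⇒⊈ {K} {Any.lookup K⊆A} K#Z K⊆Z

insert-≤𝓘 : ∀ K A B {J} K#A → A ≤𝓘 B → J ∈ intervals B → K ⊆ᵢ J → insert K A K#A ≤𝓘 B
insert-≤𝓘 _ _ _ _ A≤B J∈B K⊆J = lose J∈B K⊆J ∷ A≤B

≰𝓘-insert : ∀ K A B {J} K#A → J ∈ intervals B → ¬ J ⊆ᵢ K → ¬ Any (J ⊆ᵢ_) (intervals A) →
            ¬ B ≤𝓘 insert K A K#A
≰𝓘-insert _ _ _ _ J∈B J⊈K J⊈A B≤C with All.lookup B≤C J∈B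
... | here J⊆K = J⊈K J⊆K
... | there J⊆A = J⊈A J⊆A

proposition6p15 : (A B : 𝓘) → A <𝓘 B → Σ 𝓘 (λ C → A <𝓘 C × C <𝓘 B)
proposition6p15 A B (A≤B , B≰A) with ≰𝓘⇒uncovered B A B≰A
... | J , J∈B , J⊈A with cut-point (disjoint A) J J⊈A
...   | b , loJ≤b , b<hiJ , b∉A
          with fresh-interval (≤-trans (0≤lo J) loJ≤b) b<hiJ (hi≤1 J) (intervals A) b∉A
...     | K , b<loK , hiK≤hiJ , K#A =
  insert K A K#A , (≤𝓘-insert K A K#A , insert-≰𝓘 K A K#A) ,
                   (insert-≤𝓘 K A B K#A A≤B J∈B K⊆J , ≰𝓘-insert K A B K#A J∈B J⊈K J⊈A)
  where
  K⊆J : K ⊆ᵢ J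
  K⊆J = ≤-trans loJ≤b (<⇒≤ b<loK) , hiK≤hiJ

  J⊈K : ¬ J ⊆ᵢ K
  J⊈K (loK≤loJ , _) = <-irrefl refl (<-≤-trans (≤-<-trans loJ≤b b<loK) loK≤loJ)
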